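{- For any pair of bipartite graphs $G$ and $H$, $$\gamma_{\rm sp}(G\Box H)\ge \alpha(G)\alpha(H)+\min\{\beta(G),\beta(H)\}.$$
   Context: All graphs are finite, simple and undirected. For a vertex $v$, $N(v)$ is its set of neighbours; for $D\subseteq V(G)$, $\overline{D}=V(G)\setminus D$. A set $D\subseteq V(G)$ is a super dominating set of $G$ if for every $u\in\overline{D}$ there exists $v\in D$ such that $N(v)\cap\overline{D}=\{u\}$; the super domination number $\gamma_{\rm sp}(G)$ is the minimum cardinality of a super dominating set of $G$. $\alpha(G)$ is the independence number (maximum cardinality of a set of pairwise non-adjacent vertices) and $\beta(G)$ is the vertex cover number (minimum cardinality of a set of vertices meeting every edge). The Cartesian product $G\Box H$ has vertex set $V(G)\times V(H)$, with $(g,h)$ adjacent to $(g',h')$ iff either $g=g'$ and $hh'\in E(H)$, or $gg'\in E(G)$ and $h=h'$. -}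

module Defs where

open import Data.Nat using (ℕ; _*_; _≤_)
open import Data.Bool using (Bool; true; false)
open import Data.Fin using (Fin; remQuot)
open import Data.Fin.Subset using (Subset; _∈_; _∉_; ∣_∣)
open import Data.Product using (Σ; _×_; _,_; proj₁; proj₂)
open import Data.Sum using (_⊎_)
open import Relation.Binary.PropositionalEquality using (_≡_; _≢_)

record Graph : Set where
  field
    n      : ℕ
    adj    : Fin n → Fin n → Bool
    sym    : ∀ u v → adj u v ≡ adj v u
    irrefl : ∀ u → adj u u ≡ false
open Graph public

Bipartite : Graph → Set
Bipartite G = Σ (Fin (n G) → Bool) λ c → ∀ u v → adj G u v ≡ true → c u ≢ c v

Independent : (G : Graph) → Subset (n G) → Set
Independent G S = ∀ u v → u ∈ S → v ∈ S → adj G u v ≡ false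

VertexCover : (G : Graph) → Subset (n G) → Set
VertexCover G S = ∀ u v → adj G u v ≡ true → u ∈ S ⊎ v ∈ S

SuperDominating : (G : Graph) → Subset (n G) → Set
SuperDominating G D =
  ∀ u → u ∉ D →
    Σ (Fin (n G)) λ v → v ∈ D × adj G v u ≡ true ×
      (∀ w → w ∉ D → adj G v w ≡ true → w ≡ u)

IsMaxCard : {m : ℕ} → (Subset m → Set) → ℕ → Set
IsMaxCard {m} P k = Σ (Subset m) (λ S → P S × ∣ S ∣ ≡ k) × (∀ S → P S → ∣ S ∣ ≤ k)

IsMinCard : {m : ℕ} → (Subset m → Set) → ℕ → Set
IsMinCard {m} P k = Σ (Subset m) (λ S → P S × ∣ S ∣ ≡ k) × (∀ S → P S → k ≤ ∣ S ∣)

IsIndependenceNumber : Graph → ℕ → Set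
IsIndependenceNumber G = IsMaxCard (Independent G)

IsVertexCoverNumber : Graph → ℕ → Set
IsVertexCoverNumber G = IsMinCard (VertexCover G)

IsSuperDominationNumber : Graph → ℕ → Set
IsSuperDominationNumber G = IsMinCard (SuperDominating G)

open import Data.Fin using (_≟_)
open import Relation.Nullary using (does; yes; no)
open import Data.Bool using (_∧_; _∨_)
open import Data.Bool.Properties using ()
open import Relation.Binary.PropositionalEquality using (refl; cong₂)
  renaming (sym to ≡-sym)

□-adjP : (G H : Graph) → Fin (n G) × Fin (n H) → Fin (n G) × Fin (n H) → Bool
□-adjP G H (g , h) (g′ , h′) =
  (does (g ≟ g′) ∧ adj H h h′) ∨ (adj G g g′ ∧ does (h ≟ h′))

□-adj : (G H : Graph) → Fin (n G * n H) → Fin (n G * n H) → Bool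
□-adj G H x y = □-adjP G H (remQuot {n G} (n H) x) (remQuot {n G} (n H) y)

private
  does-sym : ∀ {k} (a b : Fin k) → does (a ≟ b) ≡ does (b ≟ a)
  does-sym a b with a ≟ b | b ≟ a
  ... | yes _ | yes _ = refl
  ... | no _ | no _ = refl
  ... | yes p | no q = Data.Empty.⊥-elim (q (≡-sym p))
    where import Data.Empty
  ... | no p | yes q = Data.Empty.⊥-elim (p (≡-sym q))
    where import Data.Empty

  does-refl : ∀ {k} (a : Fin k) → does (a ≟ a) ≡ true
  does-refl a with a ≟ a
  ... | yes _ = refl
  ... | no p = Data.Empty.⊥-elim (p refl)
    where import Data.Empty

  □-symP : (G H : Graph) → ∀ p q → □-adjP G H p q ≡ □-adjP G H q p
  □-symP G H (g , h) (g′ , h′) =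
    cong₂ _∨_ (cong₂ _∧_ (does-sym g g′) (Graph.sym H h h′))
              (cong₂ _∧_ (Graph.sym G g g′) (does-sym h h′))

  □-irreflP : (G H : Graph) → ∀ p → □-adjP G H p p ≡ false
  □-irreflP G H (g , h) rewrite does-refl g | does-refl h
    | irrefl H h | irrefl G g = refl

-- Cartesian product G □ H on vertex set Fin (n G * n H); vertex x is
-- identified with the pair remQuot (n H) x ∈ Fin (n G) × Fin (n H)
-- (a bijection, inverse Data.Fin.combine).
_□_ : Graph → Graph → Graph
G □ H = record
  { n = n G * n H
  ; adj = □-adj G H
  ; sym = λ x y → □-symP G H (remQuot {n G} (n H) x) (remQuot {n G} (n H) y)
  ; irrefl = λ x → □-irreflP G H (remQuot {n G} (n H) x)
  }

-- A super dominating set D is at least as large as any independent set S: send s ∈ S to s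
-- itself if s ∈ D and otherwise to a neighbour in D whose only neighbour outside D is s;
-- two non-adjacent vertices never share an image.  So it suffices to exhibit a large
-- independent set of G □ H.  For maximum independent sets I of G and J of H, the set I × J
-- is independent, and so is its union with a "diagonal" (x₁ , y₁), …, (x_k , y_k) of distinct
-- x_t ∉ I and distinct y_t ∉ J, k = min (|V G| - |I|) (|V H| - |J|): these differ from each
-- other and from I × J in both coordinates.  The complements of I and J are vertex covers,
-- so k ≥ min β(G) β(H).
module Submission where

open import Defs hiding (sym)
open import Data.Nat using (ℕ; _+_; _*_; _⊓_; _≤_)
open import Data.Nat.Properties
  using (+-monoʳ-≤; ⊓-mono-≤; m⊓n≤m; m⊓n≤n; module ≤-Reasoning)
open import Data.Bool using (true; false)
open import Data.Bool.Properties using (∧-zeroʳ)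
open import Data.Fin using (Fin; zero; suc; combine; inject≤; _≟_)
open import Data.Fin.Properties using
  (suc-injective; injective⇒≤; inject≤-injective; combine-injective; remQuot-combine; +↔⊎; *↔×)
open import Data.Fin.Subset using (Subset; _∈_; _∉_; ∣_∣; ∁)
open import Data.Fin.Subset.Properties using (_∈?_; x∈∁p⇒x∉p; x∉p⇒x∈∁p)
open import Data.Vec using (_∷_; here; there)
open import Data.Product using (_×_; _,_; proj₁; proj₂)
open import Data.Sum using (_⊎_; inj₁; inj₂)
open import Data.Sum.Function.Propositional using (_⊎-↔_)
open import Data.Empty using (⊥; ⊥-elim)
open import Function using (_∘_; Injective; _↔_; Inverse; Injection)
open import Function.Construct.Composition using (_↔-∘_)
open import Function.Properties.Inverse using (↔-refl; ↔⇒↣)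
open import Relation.Nullary using (yes; no)
open import Relation.Binary.PropositionalEquality
  using (_≡_; _≢_; refl; sym; trans; cong; cong₂; subst)

private
  variable
    k m : ℕ

true≢false : ∀ {b} → b ≡ true → b ≡ false → ⊥
true≢false refl ()

enum : (p : Subset m) → Fin ∣ p ∣ → Fin m
enum (true ∷ p) zero = zero
enum (true ∷ p) (suc i) = suc (enum p i)
enum (false ∷ p) i = suc (enum p i)

enum-∈ : (p : Subset m) (i : Fin ∣ p ∣) → enum p i ∈ p
enum-∈ (true ∷ p) zero = here
enum-∈ (true ∷ p) (suc i) = there (enum-∈ p i)
enum-∈ (false ∷ p) i = there (enum-∈ p i)

enum-injective : (p : Subset m) → Injective _≡_ _≡_ (enum p)
enum-injective (true ∷ p) {zero} {zero} e = refl
enum-injective (true ∷ p) {suc i} {suc j} e = cong suc (enum-injective p (suc-injective e))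
enum-injective (false ∷ p) e = enum-injective p (suc-injective e)

rank : (p : Subset m) {x : Fin m} → x ∈ p → Fin ∣ p ∣
rank (true ∷ p) here = zero
rank (true ∷ p) (there x∈p) = suc (rank p x∈p)
rank (false ∷ p) (there x∈p) = rank p x∈p

rank-injective : (p : Subset m) {x y : Fin m} (x∈p : x ∈ p) (y∈p : y ∈ p) →
  rank p x∈p ≡ rank p y∈p → x ≡ y
rank-injective (true ∷ p) here here e = refl
rank-injective (true ∷ p) (there x∈p) (there y∈p) e =
  cong suc (rank-injective p x∈p y∈p (suc-injective e))
rank-injective (false ∷ p) (there x∈p) (there y∈p) e =
  cong suc (rank-injective p x∈p y∈p e)

injective-into⇒≤∣p∣ : (p : Subset m) {f : Fin k → Fin m} →
  Injective _≡_ _≡_ f → (∀ i → f i ∈ p) → k ≤ ∣ p ∣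
injective-into⇒≤∣p∣ p f-inj f∈p =
  injective⇒≤ (λ e → f-inj (rank-injective p (f∈p _) (f∈p _) e))

module _ (p : Subset m) (k≤∣∁p∣ : k ≤ ∣ ∁ p ∣) where

  enum-∁ : Fin k → Fin m
  enum-∁ t = enum (∁ p) (inject≤ t k≤∣∁p∣)

  enum-∁-injective : Injective _≡_ _≡_ enum-∁
  enum-∁-injective e = inject≤-injective _ _ _ _ (enum-injective (∁ p) e)

  enum-∁-∉ : ∀ t → enum-∁ t ∉ p
  enum-∁-∉ t = x∈∁p⇒x∉p (enum-∈ (∁ p) _)

independent⇒∁-vertexCover : (G : Graph) {I : Subset (n G)} →
  Independent G I → VertexCover G (∁ I)
independent⇒∁-vertexCover G {I} ind u v u~v with u ∈? I | v ∈? I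
... | yes u∈I | yes v∈I = ⊥-elim (true≢false u~v (ind u v u∈I v∈I))
... | no u∉I  | _       = inj₁ (x∉p⇒x∈∁p u∉I)
... | yes _   | no v∉I  = inj₂ (x∉p⇒x∈∁p v∉I)

module SuperDominator (G : Graph) {D : Subset (n G)} (sd : SuperDominating G D) where

  module _ {s : Fin (n G)} (s∉D : s ∉ D) where

    privateDominator : Fin (n G)
    privateDominator = proj₁ (sd s s∉D)

    privateDominator-∈ : privateDominator ∈ D
    privateDominator-∈ = proj₁ (proj₂ (sd s s∉D))

    privateDominator-adj : adj G privateDominator s ≡ true
    privateDominator-adj = proj₁ (proj₂ (proj₂ (sd s s∉D)))

    privateDominator-unique : ∀ {w} → w ∉ D → adj G privateDominator w ≡ true → w ≡ s
    privateDominator-unique {w} = proj₂ (proj₂ (proj₂ (sd s s∉D))) w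

  dominator : Fin (n G) → Fin (n G)
  dominator s with s ∈? D
  ... | yes _   = s
  ... | no s∉D  = privateDominator s∉D

  dominator-∈ : ∀ s → dominator s ∈ D
  dominator-∈ s with s ∈? D
  ... | yes s∈D = s∈D
  ... | no s∉D  = privateDominator-∈ s∉D

  dominator-injective : ∀ {s t} → adj G s t ≡ false → dominator s ≡ dominator t → s ≡ t
  dominator-injective {s} {t} s≁t e with s ∈? D | t ∈? D
  ... | yes _  | yes _  = e
  ... | yes _  | no t∉D = ⊥-elim (true≢false s~t s≁t)
    where
    s~t : adj G s t ≡ true
    s~t = subst (λ v → adj G v t ≡ true) (sym e) (privateDominator-adj t∉D)
  ... | no s∉D | yes _  = ⊥-elim (true≢false t~s (trans (Graph.sym G t s) s≁t))
    where
    t~s : adj G t s ≡ true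
    t~s = subst (λ v → adj G v s ≡ true) e (privateDominator-adj s∉D)
  ... | no s∉D | no t∉D = sym (privateDominator-unique s∉D t∉D dominator~t)
    where
    dominator~t : adj G (privateDominator s∉D) t ≡ true
    dominator~t = subst (λ v → adj G v t ≡ true) (sym e) (privateDominator-adj t∉D)

  independent≤∣D∣ : {f : Fin k → Fin (n G)} → Injective _≡_ _≡_ f →
    (∀ i j → adj G (f i) (f j) ≡ false) → k ≤ ∣ D ∣
  independent≤∣D∣ {f = f} f-inj f-ind =
    injective-into⇒≤∣p∣ D (λ e → f-inj (dominator-injective (f-ind _ _) e)) (dominator-∈ ∘ f)

□-adj-combine : (G H : Graph) (g g′ : Fin (n G)) (h h′ : Fin (n H)) →
  adj (G □ H) (combine g h) (combine g′ h′) ≡ □-adjP G H (g , h) (g′ , h′)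
□-adj-combine G H g g′ h h′ =
  cong₂ (□-adjP G H) (remQuot-combine g h) (remQuot-combine g′ h′)

□-nonadjacent : (G H : Graph) {g g′ : Fin (n G)} {h h′ : Fin (n H)} →
  (g ≡ g′ → adj H h h′ ≡ false) → (h ≡ h′ → adj G g g′ ≡ false) →
  adj (G □ H) (combine g h) (combine g′ h′) ≡ false
□-nonadjacent G H {g} {g′} {h} {h′} sameG sameH =
  trans (□-adj-combine G H g g′ h h′) adjP-false
  where
  adjP-false : □-adjP G H (g , h) (g′ , h′) ≡ false
  adjP-false with g ≟ g′ | h ≟ h′
  ... | yes g≡g′ | yes h≡h′ rewrite sameG g≡g′ | sameH h≡h′ = refl
  ... | yes g≡g′ | no _     rewrite sameG g≡g′ = ∧-zeroʳ (adj G g g′)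
  ... | no _     | yes h≡h′ rewrite sameH h≡h′ = refl
  ... | no _     | no _     = ∧-zeroʳ (adj G g g′)

module DiagonalExtension (G H : Graph) {I : Subset (n G)} {J : Subset (n H)}
  (I-ind : Independent G I) (J-ind : Independent H J)
  (x : Fin k → Fin (n G)) (y : Fin k → Fin (n H))
  (x-inj : Injective _≡_ _≡_ x) (y-inj : Injective _≡_ _≡_ y)
  (x∉I : ∀ t → x t ∉ I) (y∉J : ∀ t → y t ∉ J) where

  Index : Set
  Index = (Fin ∣ I ∣ × Fin ∣ J ∣) ⊎ Fin k

  pair : Index → Fin (n G) × Fin (n H)
  pair (inj₁ (s , t)) = enum I s , enum J t
  pair (inj₂ t)       = x t , y t

  enum-I≢x : ∀ s t → enum I s ≢ x t
  enum-I≢x s t e = x∉I t (subst (_∈ I) e (enum-∈ I s))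

  enum-J≢y : ∀ s t → enum J s ≢ y t
  enum-J≢y s t e = y∉J t (subst (_∈ J) e (enum-∈ J s))

  pair-injective : Injective _≡_ _≡_ pair
  pair-injective {inj₁ _} {inj₁ _} e =
    cong inj₁ (cong₂ _,_ (enum-injective I (cong proj₁ e)) (enum-injective J (cong proj₂ e)))
  pair-injective {inj₁ (s , _)} {inj₂ t} e = ⊥-elim (enum-I≢x s t (cong proj₁ e))
  pair-injective {inj₂ t} {inj₁ (s , _)} e = ⊥-elim (enum-I≢x s t (cong proj₁ (sym e)))
  pair-injective {inj₂ _} {inj₂ _} e = cong inj₂ (x-inj (cong proj₁ e))

  sameG⇒nonadjacent : ∀ u v → proj₁ (pair u) ≡ proj₁ (pair v) →
    adj H (proj₂ (pair u)) (proj₂ (pair v)) ≡ false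
  sameG⇒nonadjacent (inj₁ _) (inj₁ _) _ = J-ind _ _ (enum-∈ J _) (enum-∈ J _)
  sameG⇒nonadjacent (inj₁ (s , _)) (inj₂ t) e = ⊥-elim (enum-I≢x s t e)
  sameG⇒nonadjacent (inj₂ t) (inj₁ (s , _)) e = ⊥-elim (enum-I≢x s t (sym e))
  sameG⇒nonadjacent (inj₂ t) (inj₂ _) e with refl ← x-inj e = irrefl H (y t)

  sameH⇒nonadjacent : ∀ u v → proj₂ (pair u) ≡ proj₂ (pair v) →
    adj G (proj₁ (pair u)) (proj₁ (pair v)) ≡ false
  sameH⇒nonadjacent (inj₁ _) (inj₁ _) _ = I-ind _ _ (enum-∈ I _) (enum-∈ I _)
  sameH⇒nonadjacent (inj₁ (_ , s)) (inj₂ t) e = ⊥-elim (enum-J≢y s t e)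
  sameH⇒nonadjacent (inj₂ t) (inj₁ (_ , s)) e = ⊥-elim (enum-J≢y s t (sym e))
  sameH⇒nonadjacent (inj₂ t) (inj₂ _) e with refl ← y-inj e = irrefl G (x t)

  vertex : Index → Fin (n G * n H)
  vertex u = combine (proj₁ (pair u)) (proj₂ (pair u))

  vertex-injective : Injective _≡_ _≡_ vertex
  vertex-injective {u} {v} e
    with e₁ , e₂ ← combine-injective
                     (proj₁ (pair u)) (proj₂ (pair u)) (proj₁ (pair v)) (proj₂ (pair v)) e
    = pair-injective (cong₂ _,_ e₁ e₂)

  vertex-nonadjacent : ∀ u v → adj (G □ H) (vertex u) (vertex v) ≡ false
  vertex-nonadjacent u v =
    □-nonadjacent G H (sameG⇒nonadjacent u v) (sameH⇒nonadjacent u v)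

  index : Fin (∣ I ∣ * ∣ J ∣ + k) ↔ Index
  index = (*↔× ⊎-↔ ↔-refl) ↔-∘ +↔⊎

  ∣I∣*∣J∣+k≤∣D∣ : {D : Subset (n G * n H)} → SuperDominating (G □ H) D →
    ∣ I ∣ * ∣ J ∣ + k ≤ ∣ D ∣
  ∣I∣*∣J∣+k≤∣D∣ sd = SuperDominator.independent≤∣D∣ (G □ H) sd
    {f = vertex ∘ Inverse.to index}
    (λ e → Injection.injective (↔⇒↣ index) (vertex-injective e))
    (λ i j → vertex-nonadjacent (Inverse.to index i) (Inverse.to index j))

independent×independent≤superDominating :
  (G H : Graph) {I : Subset (n G)} {J : Subset (n H)} →
  Independent G I → Independent H J →
  {D : Subset (n G * n H)} → SuperDominating (G □ H) D →
  ∣ I ∣ * ∣ J ∣ + (∣ ∁ I ∣ ⊓ ∣ ∁ J ∣) ≤ ∣ D ∣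
independent×independent≤superDominating G H {I} {J} I-ind J-ind =
  DiagonalExtension.∣I∣*∣J∣+k≤∣D∣ G H I-ind J-ind
    (enum-∁ I k≤∣∁I∣) (enum-∁ J k≤∣∁J∣)
    (enum-∁-injective I k≤∣∁I∣) (enum-∁-injective J k≤∣∁J∣)
    (enum-∁-∉ I k≤∣∁I∣) (enum-∁-∉ J k≤∣∁J∣)
  where
  k≤∣∁I∣ : ∣ ∁ I ∣ ⊓ ∣ ∁ J ∣ ≤ ∣ ∁ I ∣
  k≤∣∁I∣ = m⊓n≤m ∣ ∁ I ∣ ∣ ∁ J ∣
  k≤∣∁J∣ : ∣ ∁ I ∣ ⊓ ∣ ∁ J ∣ ≤ ∣ ∁ J ∣
  k≤∣∁J∣ = m⊓n≤n ∣ ∁ I ∣ ∣ ∁ J ∣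

theorem32 : (G H : Graph) → Bipartite G → Bipartite H →
    (a b c d g : ℕ) →
    IsIndependenceNumber G a → IsIndependenceNumber H b →
    IsVertexCoverNumber G c → IsVertexCoverNumber H d →
    IsSuperDominationNumber (G □ H) g →
    a * b + (c ⊓ d) ≤ g
theorem32 G H _ _ _ _ c d _ ((I , I-ind , refl) , _) ((J , J-ind , refl) , _)
  (_ , c-min) (_ , d-min) ((D , D-sd , refl) , _) = begin
    ∣ I ∣ * ∣ J ∣ + (c ⊓ d)             ≤⟨ +-monoʳ-≤ (∣ I ∣ * ∣ J ∣) (⊓-mono-≤ c≤∣∁I∣ d≤∣∁J∣) ⟩
    ∣ I ∣ * ∣ J ∣ + (∣ ∁ I ∣ ⊓ ∣ ∁ J ∣) ≤⟨ independent×independent≤superDominating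
                                             G H I-ind J-ind D-sd ⟩
    ∣ D ∣                               ∎
  where
  open ≤-Reasoning
  c≤∣∁I∣ : c ≤ ∣ ∁ I ∣
  c≤∣∁I∣ = c-min (∁ I) (independent⇒∁-vertexCover G I-ind)
  d≤∣∁J∣ : d ≤ ∣ ∁ J ∣
  d≤∣∁J∣ = d-min (∁ J) (independent⇒∁-vertexCover H J-ind)
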